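{- Let $d\ge 1$ and let $k>1$ be an odd integer. Suppose $S_1,\dots,S_k$ are $k$ distinct subsets of $\{1,\dots,d\}$, each of even cardinality, such that $|S_\alpha\,\triangle\, S_\beta|\ge 4$ for all $\alpha\neq\beta$ (equivalently, every edge intersection number $e_{\alpha\beta}=d-|S_\alpha\triangle S_\beta|$ satisfies $e_{\alpha\beta}\le d-4$). Then $$k(d-8)+d\ \ge\ 0 .$$ In particular, for $d\le 5$ no such configuration with odd $k>1$ exists, for $d=6$ one must have $k\le 3$, and for $d=7$ one must have $k\le 7$.
   Context: Setting: $\mathbb{C}^{2d}$ with a nondegenerate symmetric bilinear form $g$ and a canonical basis $a_1,\dots,a_d,a_1^\dagger,\dots,a_d^\dagger$ of null vectors with $g(a_i,a_j)=g(a_i^\dagger,a_j^\dagger)=0$, $g(a_i,a_j^\dagger)=\delta_{ij}$. For a pure spinor $\psi_0$ annihilated (under Clifford multiplication) by $a_1,\dots,a_d$, the basis pure spinors of the semi-spinor space $S^+$ are $\psi_S=\prod_{i\in S}a_i^\dagger\psi_0$ for even-size subsets $S\subseteq\{1,\dots,d\}$. The null (annihilator) subspace of $\psi_S$ is $M(\psi_S)=\mathrm{Span}(\{a_i: i\notin S\}\cup\{a_i^\dagger: i\in S\})$, of dimension $d$, and $\dim(M(\psi_S)\cap M(\psi_T))=d-|S\triangle T|$. The condition $|S_\alpha\triangle S_\beta|\ge4$ says that no two of the pure spinors $\psi_{S_\alpha}$ have null subspaces meeting in dimension $\ge d-2$ (so no pair sums to a pure spinor). -}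

module Defs where

open import Data.Nat using (ℕ)
open import Data.Nat.Divisibility using (_∣_)
open import Data.Fin.Subset using (Subset; _∪_; _─_)

_△_ : ∀ {d} → Subset d → Subset d → Subset d
S △ T = (S ─ T) ∪ (T ─ S)

Even : ℕ → Set
Even n = 2 ∣ n

{-# OPTIONS --safe #-}
module Submission where

-- Double count T = ∑_{α,β} |S_α △ S_β|. Separation gives T ≥ 4k(k − 1). Column by column, a
-- coordinate lying in t of the sets and missing from f = k − t of them contributes 2tf to T; as
-- t + f = k is odd, t ≠ f and so 4tf ≤ k² − 1, whence 2T ≤ d(k² − 1). Thus 8k(k − 1) ≤ d(k² − 1),
-- and cancelling k − 1 > 0 leaves 8k ≤ d(k + 1).

open import Defs
open import Data.Nat using (ℕ; _≤_; _<_)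
open import Data.Nat.Divisibility using (_∣_)
open import Data.Fin using (Fin)
open import Data.Fin.Subset using (Subset; ∣_∣)
open import Function.Definitions using (Injective)
open import Relation.Binary.PropositionalEquality using (_≡_)
open import Relation.Nullary using (¬_)

module DoubleCounting where

  open import Data.Bool using (Bool; true; false; not; _xor_)
  open import Data.Fin using (zero; suc; punchIn)
  open import Data.Fin.Properties using (punchInᵢ≢i)
  open import Data.Nat
  open import Data.Nat.Properties
  open import Data.Nat.Divisibility using (divides)
  open import Data.Nat.Tactic.RingSolver using (solve-∀)
  open import Function using (_∘′_)
  open import Data.Product using (_,_)
  open import Data.Vec using ([]; _∷_; lookup)
  open import Data.Vec.Functional using (removeAt)
  open import Algebra.Properties.Semiring.Sum +-*-semiring
    using (sum; sum-syntax; sum-cong-≗; sum-remove; ∑-distrib-+; ∑-comm; *-distribˡ-sum; *-distribʳ-sum)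
  open import Relation.Binary using (tri<; tri≈; tri>)
  open import Relation.Binary.PropositionalEquality
  open import Relation.Nullary using (contradiction)

  ∑-const : ∀ n c → ∑[ i < n ] c ≡ n * c
  ∑-const zero    c = refl
  ∑-const (suc n) c = cong (c +_) (∑-const n c)

  ∑-mono-≤ : ∀ {n} {f g : Fin n → ℕ} → (∀ i → f i ≤ g i) → sum f ≤ sum g
  ∑-mono-≤ {zero}  f≤g = z≤n
  ∑-mono-≤ {suc n} f≤g = +-mono-≤ (f≤g zero) (∑-mono-≤ λ i → f≤g (suc i))

  ∑-*-∑ : ∀ {m n} (f : Fin m → ℕ) (g : Fin n → ℕ) →
          sum f * sum g ≡ ∑[ i < m ] ∑[ j < n ] (f i * g j)
  ∑-*-∑ f g = trans (*-distribʳ-sum (sum g) f) (sum-cong-≗ λ i → *-distribˡ-sum (f i) g)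

  ∑-≥-except : ∀ {n} c (f : Fin n → ℕ) i → (∀ j → j ≢ i → c ≤ f j) → n * c ≤ sum f + c
  ∑-≥-except {suc n} c f i c≤f = begin
    suc n * c                    ≡⟨ +-comm c (n * c) ⟩
    n * c + c                    ≡⟨ cong (_+ c) (∑-const n c) ⟨
    ∑[ j < n ] c + c             ≤⟨ +-monoˡ-≤ c (∑-mono-≤ λ j → c≤f (punchIn i j) (punchInᵢ≢i i j)) ⟩
    sum (removeAt f i) + c       ≤⟨ +-monoˡ-≤ c (m≤n+m _ (f i)) ⟩
    f i + sum (removeAt f i) + c ≡⟨ cong (_+ c) (sum-remove f) ⟨
    sum f + c                    ∎
    where open ≤-Reasoning

  <⇒4mn<[m+n]² : ∀ {m n} → m < n → 4 * (m * n) < (m + n) * (m + n)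
  <⇒4mn<[m+n]² {m} m<n with t , refl ← m≤n⇒∃[o]m+o≡n m<n =
    subst (4 * (m * (suc m + t)) <_) (sym (square-gap m t)) (m<m+n _ z<s)
    where
    square-gap : ∀ m t → (m + (suc m + t)) * (m + (suc m + t))
                         ≡ 4 * (m * (suc m + t)) + suc t * suc t
    square-gap = solve-∀

  4mn<[m+n]² : ∀ m n → ¬ 2 ∣ m + n → 4 * (m * n) < (m + n) * (m + n)
  4mn<[m+n]² m n odd with <-cmp m n
  ... | tri< m<n _ _ = <⇒4mn<[m+n]² m<n
  ... | tri≈ _ refl _ = contradiction (divides m (trans (cong (m +_) (sym (*-identityʳ m))) (sym (*-suc m 1)))) odd
  ... | tri> _ _ n<m = subst₂ (λ a b → 4 * a < b) (*-comm n m) (cong (λ s → s * s) (+-comm n m))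
                         (<⇒4mn<[m+n]² n<m)

  𝟙 : Bool → ℕ
  𝟙 true  = 1
  𝟙 false = 0

  𝟙-xor : ∀ a b → 𝟙 (a xor b) ≡ 𝟙 a * 𝟙 (not b) + 𝟙 (not a) * 𝟙 b
  𝟙-xor true  true  = refl
  𝟙-xor true  false = refl
  𝟙-xor false true  = refl
  𝟙-xor false false = refl

  𝟙-+-𝟙-not : ∀ a → 𝟙 a + 𝟙 (not a) ≡ 1
  𝟙-+-𝟙-not true  = refl
  𝟙-+-𝟙-not false = refl

  ∣△∣-∷ : ∀ {d} x y (xs ys : Subset d) → ∣ (x ∷ xs) △ (y ∷ ys) ∣ ≡ 𝟙 (x xor y) + ∣ xs △ ys ∣
  ∣△∣-∷ true  true  xs ys = refl
  ∣△∣-∷ true  false xs ys = refl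
  ∣△∣-∷ false true  xs ys = refl
  ∣△∣-∷ false false xs ys = refl

  ∣△∣≡∑xor : ∀ {d} (u v : Subset d) → ∣ u △ v ∣ ≡ ∑[ i < d ] 𝟙 (lookup u i xor lookup v i)
  ∣△∣≡∑xor []       []       = refl
  ∣△∣≡∑xor (x ∷ xs) (y ∷ ys) = trans (∣△∣-∷ x y xs ys) (cong (𝟙 (x xor y) +_) (∣△∣≡∑xor xs ys))

  trues falses : ∀ {k} → (Fin k → Bool) → ℕ
  trues  {k} x = ∑[ α < k ] 𝟙 (x α)
  falses {k} x = ∑[ α < k ] 𝟙 (not (x α))

  trues+falses≡k : ∀ {k} (x : Fin k → Bool) → trues x + falses x ≡ k
  trues+falses≡k {k} x = begin
    trues x + falses x                    ≡⟨ ∑-distrib-+ (𝟙 ∘′ x) (𝟙 ∘′ not ∘′ x) ⟨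
    ∑[ α < k ] (𝟙 (x α) + 𝟙 (not (x α))) ≡⟨ sum-cong-≗ (λ α → 𝟙-+-𝟙-not (x α)) ⟩
    ∑[ α < k ] 1                          ≡⟨ ∑-const k 1 ⟩
    k * 1                                 ≡⟨ *-identityʳ k ⟩
    k                                     ∎
    where open ≡-Reasoning

  disagreements : ∀ {k} → (Fin k → Bool) → ℕ
  disagreements {k} x = ∑[ α < k ] ∑[ β < k ] 𝟙 (x α xor x β)

  disagreements≡trues*falses+falses*trues : ∀ {k} (x : Fin k → Bool) → disagreements x ≡ trues x * falses x + falses x * trues x
  disagreements≡trues*falses+falses*trues {k} x = begin
    disagreements x
      ≡⟨ sum-cong-≗ (λ α → sum-cong-≗ λ β → 𝟙-xor (x α) (x β)) ⟩
    ∑[ α < k ] ∑[ β < k ] (t α * f β + f α * t β)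
      ≡⟨ sum-cong-≗ (λ α → ∑-distrib-+ (λ β → t α * f β) (λ β → f α * t β)) ⟩
    ∑[ α < k ] (∑[ β < k ] (t α * f β) + ∑[ β < k ] (f α * t β))
      ≡⟨ ∑-distrib-+ (λ α → ∑[ β < k ] (t α * f β)) (λ α → ∑[ β < k ] (f α * t β)) ⟩
    ∑[ α < k ] ∑[ β < k ] (t α * f β) + ∑[ α < k ] ∑[ β < k ] (f α * t β)
      ≡⟨ cong₂ _+_ (∑-*-∑ t f) (∑-*-∑ f t) ⟨
    trues x * falses x + falses x * trues x
      ∎
    where
    open ≡-Reasoning
    t f : Fin k → ℕ
    t α = 𝟙 (x α)
    f α = 𝟙 (not (x α))

  2*disagreements<k² : ∀ {k} (x : Fin k → Bool) → ¬ 2 ∣ k → 2 * disagreements x < k * k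
  2*disagreements<k² {k} x odd = subst₂ _<_ (sym 2*D≡4tf) (cong (λ s → s * s) (trues+falses≡k x))
    (4mn<[m+n]² (trues x) (falses x) (odd ∘′ subst (2 ∣_) (trues+falses≡k x)))
    where
    double : ∀ t f → 2 * (t * f + f * t) ≡ 4 * (t * f)
    double = solve-∀
    2*D≡4tf : 2 * disagreements x ≡ 4 * (trues x * falses x)
    2*D≡4tf = trans (cong (2 *_) (disagreements≡trues*falses+falses*trues x)) (double (trues x) (falses x))

  distanceSum : ∀ {k d} → (Fin k → Subset d) → ℕ
  distanceSum {k} S = ∑[ α < k ] ∑[ β < k ] ∣ S α △ S β ∣

  column : ∀ {k d} → (Fin k → Subset d) → Fin d → Fin k → Bool
  column S i α = lookup (S α) i

  distanceSum≡∑disagreements : ∀ {k d} (S : Fin k → Subset d) →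
                               distanceSum S ≡ ∑[ i < d ] disagreements (column S i)
  distanceSum≡∑disagreements {k} {d} S = begin
    distanceSum S
      ≡⟨ sum-cong-≗ (λ α → sum-cong-≗ λ β → ∣△∣≡∑xor (S α) (S β)) ⟩
    ∑[ α < k ] ∑[ β < k ] ∑[ i < d ] differ i α β
      ≡⟨ sum-cong-≗ (λ α → ∑-comm (λ β i → differ i α β)) ⟩
    ∑[ α < k ] ∑[ i < d ] ∑[ β < k ] differ i α β
      ≡⟨ ∑-comm (λ α i → ∑[ β < k ] differ i α β) ⟩
    ∑[ i < d ] disagreements (column S i)
      ∎
    where
    open ≡-Reasoning
    differ : Fin d → Fin k → Fin k → ℕ
    differ i α β = 𝟙 (column S i α xor column S i β)

  distanceSum-upper : ∀ {k d} (S : Fin k → Subset d) → ¬ 2 ∣ k → 2 * distanceSum S + d ≤ d * (k * k)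
  distanceSum-upper {k} {d} S odd = begin
    2 * distanceSum S + d                ≡⟨ cong₂ _+_ 2*T≡∑2D (sym (*-identityʳ d)) ⟩
    ∑[ i < d ] (2 * D i) + d * 1         ≡⟨ cong (∑[ i < d ] (2 * D i) +_) (∑-const d 1) ⟨
    ∑[ i < d ] (2 * D i) + ∑[ i < d ] 1  ≡⟨ ∑-distrib-+ (λ i → 2 * D i) (λ _ → 1) ⟨
    ∑[ i < d ] (2 * D i + 1)             ≤⟨ ∑-mono-≤ column-bound ⟩
    ∑[ i < d ] (k * k)                   ≡⟨ ∑-const d (k * k) ⟩
    d * (k * k)                          ∎
    where
    open ≤-Reasoning
    D : Fin d → ℕ
    D i = disagreements (column S i)
    2*T≡∑2D : 2 * distanceSum S ≡ ∑[ i < d ] (2 * D i)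
    2*T≡∑2D = trans (cong (2 *_) (distanceSum≡∑disagreements S)) (*-distribˡ-sum 2 D)
    column-bound : ∀ i → 2 * D i + 1 ≤ k * k
    column-bound i = subst (_≤ k * k) (+-comm 1 _) (2*disagreements<k² (column S i) odd)

  distanceSum-lower : ∀ {k d} (S : Fin k → Subset d) →
                      (∀ α β → α ≢ β → 4 ≤ ∣ S α △ S β ∣) → k * (k * 4) ≤ distanceSum S + k * 4
  distanceSum-lower {k} S separated = begin
    k * (k * 4)                                  ≡⟨ ∑-const k (k * 4) ⟨
    ∑[ α < k ] (k * 4)                           ≤⟨ ∑-mono-≤ row-bound ⟩
    ∑[ α < k ] (∑[ β < k ] ∣ S α △ S β ∣ + 4)    ≡⟨ ∑-distrib-+ (λ α → ∑[ β < k ] ∣ S α △ S β ∣) (λ _ → 4) ⟩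
    distanceSum S + ∑[ α < k ] 4                 ≡⟨ cong (distanceSum S +_) (∑-const k 4) ⟩
    distanceSum S + k * 4                        ∎
    where
    open ≤-Reasoning
    row-bound : ∀ α → k * 4 ≤ ∑[ β < k ] ∣ S α △ S β ∣ + 4
    row-bound α = ∑-≥-except 4 _ α λ β β≢α → separated α β (β≢α ∘′ sym)

  8k≤dk+d : ∀ {k d} (S : Fin k → Subset d) → 1 < k → ¬ 2 ∣ k →
            (∀ α β → α ≢ β → 4 ≤ ∣ S α △ S β ∣) → 8 * k ≤ d * k + d
  8k≤dk+d {suc j@(suc _)} {d} S (s≤s (s≤s _)) odd separated =
    *-cancelʳ-≤ (8 * k) (d * k + d) j (+-cancelʳ-≤ (8 * k + d + 2 * T) _ _ (begin
      8 * k * j + (8 * k + d + 2 * T)  ≡⟨ lhs-shape j d T ⟩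
      2 * (k * (k * 4)) + (2 * T + d)  ≤⟨ +-mono-≤ (*-monoʳ-≤ 2 (distanceSum-lower S separated))
                                                   (distanceSum-upper S odd) ⟩
      2 * (T + k * 4) + d * (k * k)    ≡⟨ rhs-shape j d T ⟩
      (d * k + d) * j + (8 * k + d + 2 * T) ∎))
    where
    open ≤-Reasoning
    k = suc j
    T = distanceSum S
    lhs-shape : ∀ j d T → 8 * suc j * j + (8 * suc j + d + 2 * T)
                          ≡ 2 * (suc j * (suc j * 4)) + (2 * T + d)
    lhs-shape = solve-∀
    rhs-shape : ∀ j d T → 2 * (T + suc j * 4) + d * (suc j * suc j)
                          ≡ (d * suc j + d) * j + (8 * suc j + d + 2 * T)
    rhs-shape = solve-∀

open DoubleCounting using (8k≤dk+d)

open import Data.Integer using (+_; _*_; _-_; _+_; 0ℤ; +≤+) renaming (_≤_ to _≤ℤ_)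
open import Data.Integer.Properties using (pos-*; pos-+; i≤j⇒0≤j-i)
open import Data.Integer.Tactic.RingSolver using (solve-∀)
open import Relation.Binary.PropositionalEquality using (sym; cong; cong₂; subst; module ≡-Reasoning)
open import Data.Nat using () renaming (_*_ to _*ℕ_; _+_ to _+ℕ_)

8k≤dk+d⇒0≤k[d-8]+d : ∀ d k → 8 *ℕ k ≤ d *ℕ k +ℕ d → 0ℤ ≤ℤ + k * (+ d - + 8) + + d
8k≤dk+d⇒0≤k[d-8]+d d k 8k≤dk+d = subst (0ℤ ≤ℤ_) (sym integer-form) (i≤j⇒0≤j-i (+≤+ 8k≤dk+d))
  where
  open ≡-Reasoning
  rearrange : ∀ k d e → k * (d - e) + d ≡ (d * k + d) - e * k
  rearrange = solve-∀
  integer-form : + k * (+ d - + 8) + + d ≡ + (d *ℕ k +ℕ d) - + (8 *ℕ k)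
  integer-form = begin
    + k * (+ d - + 8) + + d          ≡⟨ rearrange (+ k) (+ d) (+ 8) ⟩
    (+ d * + k + + d) - + 8 * + k    ≡⟨ cong₂ (λ a b → a + + d - b) (pos-* d k) (pos-* 8 k) ⟨
    + (d *ℕ k) + + d - + (8 *ℕ k)    ≡⟨ cong (_- + (8 *ℕ k)) (pos-+ (d *ℕ k) d) ⟨
    + (d *ℕ k +ℕ d) - + (8 *ℕ k)     ∎

mainTheorem1 : (d k : ℕ) → 1 ≤ d → 1 < k → ¬ (2 ∣ k) →
    (S : Fin k → Subset d) →
    Injective _≡_ _≡_ S →
    (∀ α → Even ∣ S α ∣) →
    (∀ α β → ¬ (α ≡ β) → 4 ≤ ∣ S α △ S β ∣) →
    0ℤ ≤ℤ (+ k) * ((+ d) - (+ 8)) + (+ d)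
mainTheorem1 d k _ 1<k odd S _ _ separated = 8k≤dk+d⇒0≤k[d-8]+d d k (8k≤dk+d S 1<k odd separated)
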